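{- The system $\mathbf{IK}$ is a conservative extension of $\mathbf{MI_{\Box}}$: for every formula $\phi$ built from proposition letters, $\top$, $\wedge$, $\to$ and $\Box$, we have $\mathbf{IK}\vdash\phi$ if and only if $\mathbf{MI_{\Box}}\vdash\phi$.
   Context: $\mathbf{MI_{\Box}}$ is derived by modus ponens from substitution instances of $p\to(q\to p)$, $(p\to(q\to r))\to((p\to q)\to(p\to r))$, $(p\wedge q)\to p$, $(p\wedge q)\to q$, $p\to(q\to(p\wedge q))$, $\top$, $\Box(p\wedge q)\leftrightarrow(\Box p\wedge\Box q)$, $\Box\top\leftrightarrow\top$, closed under the rule from $p\leftrightarrow q$ infer $\Box p\leftrightarrow\Box q$. $\mathbf{IK}$ is the intuitionistic modal logic of Plotkin and Stirling (in the language of intuitionistic propositional logic with $\Box$ and $\Diamond$); it proves $\Box(p\wedge q)\leftrightarrow(\Box p\wedge\Box q)$ and $\Box\top\leftrightarrow\top$ and is sound with respect to intuitionistic modal frames: tuples $(X,\leq,R)$ with $(X,\leq)$ a poset and $R$ a relation satisfying $({\geq}\circ R)\subseteq(R\circ{\geq})$ and $(R\circ{\leq})\subseteq({\leq}\circ R)$ (where $x(R_1\circ R_2)z$ iff $\exists y$, $xR_1y$, $yR_2z$), with valuations assigning up-closed sets, intuitionistic connectives as in Kripke semantics, $x\Vdash\Diamond\phi$ iff some $y$ with $xRy$ satisfies $\phi$, and $x\Vdash\Box\phi$ iff every $y$ with $x({\leq}\circ R)y$ satisfies $\phi$. -}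

module Defs where

open import Data.Nat using (ℕ)
open import Data.Product using (_×_)

infixr 6 _∧_
infixr 5 _∨_
infixr 4 _⇒_

data Fm : Set where
  var : ℕ → Fm
  ⊤ ⊥ : Fm
  _∧_ _∨_ _⇒_ : Fm → Fm → Fm
  □ ◇ : Fm → Fm

data IK⊢_ : Fm → Set where
  ax-k    : ∀ p q → IK⊢ (p ⇒ (q ⇒ p))
  ax-s    : ∀ p q r → IK⊢ ((p ⇒ (q ⇒ r)) ⇒ ((p ⇒ q) ⇒ (p ⇒ r)))
  ax-∧₁   : ∀ p q → IK⊢ ((p ∧ q) ⇒ p)
  ax-∧₂   : ∀ p q → IK⊢ ((p ∧ q) ⇒ q)
  ax-∧i   : ∀ p q → IK⊢ (p ⇒ (q ⇒ (p ∧ q)))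
  ax-∨₁   : ∀ p q → IK⊢ (p ⇒ (p ∨ q))
  ax-∨₂   : ∀ p q → IK⊢ (q ⇒ (p ∨ q))
  ax-∨e   : ∀ p q r → IK⊢ ((p ⇒ r) ⇒ ((q ⇒ r) ⇒ ((p ∨ q) ⇒ r)))
  ax-⊥    : ∀ p → IK⊢ (⊥ ⇒ p)
  ax-⊤    : IK⊢ ⊤
  ax-K□   : ∀ p q → IK⊢ (□ (p ⇒ q) ⇒ (□ p ⇒ □ q))
  ax-K◇   : ∀ p q → IK⊢ (□ (p ⇒ q) ⇒ (◇ p ⇒ ◇ q))
  ax-N◇   : IK⊢ (◇ ⊥ ⇒ ⊥)
  ax-◇∨   : ∀ p q → IK⊢ (◇ (p ∨ q) ⇒ (◇ p ∨ ◇ q))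
  ax-FS   : ∀ p q → IK⊢ ((◇ p ⇒ □ q) ⇒ □ (p ⇒ q))
  mp      : ∀ {p q} → IK⊢ (p ⇒ q) → IK⊢ p → IK⊢ q
  nec     : ∀ {p} → IK⊢ p → IK⊢ (□ p)

data Fm□ : Set where
  var : ℕ → Fm□
  ⊤ : Fm□
  _∧_ _⇒_ : Fm□ → Fm□ → Fm□
  □ : Fm□ → Fm□

infix 3 _⇔□_
_⇔□_ : Fm□ → Fm□ → Fm□
p ⇔□ q = (p ⇒ q) ∧ (q ⇒ p)

data MI⊢_ : Fm□ → Set where
  ax-k    : ∀ p q → MI⊢ (p ⇒ (q ⇒ p))
  ax-s    : ∀ p q r → MI⊢ ((p ⇒ (q ⇒ r)) ⇒ ((p ⇒ q) ⇒ (p ⇒ r)))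
  ax-∧₁   : ∀ p q → MI⊢ ((p ∧ q) ⇒ p)
  ax-∧₂   : ∀ p q → MI⊢ ((p ∧ q) ⇒ q)
  ax-∧i   : ∀ p q → MI⊢ (p ⇒ (q ⇒ (p ∧ q)))
  ax-⊤    : MI⊢ ⊤
  ax-□∧   : ∀ p q → MI⊢ (□ (p ∧ q) ⇔□ (□ p ∧ □ q))
  ax-□⊤   : MI⊢ (□ ⊤ ⇔□ ⊤)
  mp      : ∀ {p q} → MI⊢ (p ⇒ q) → MI⊢ p → MI⊢ q
  re      : ∀ {p q} → MI⊢ (p ⇔□ q) → MI⊢ (□ p ⇔□ □ q)

embed : Fm□ → Fm
embed (var n) = var n
embed ⊤ = ⊤
embed (p ∧ q) = embed p ∧ embed q
embed (p ⇒ q) = embed p ⇒ embed q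
embed (□ p) = □ (embed p)

{-# OPTIONS --safe #-}
-- MI□ ⊆ IK holds because every MI□ axiom and the rule RE are derivable in IK.
-- For the converse, build a canonical model whose worlds are arbitrary sets of
-- □-formulas (theories), ordered by derivability in MI□, with x R y iff y derives
-- every φ such that x derives □ φ. It satisfies the two frame conditions of
-- intuitionistic modal frames, so IK is sound in it; and on the □-fragment
-- forcing coincides with derivability (the truth lemma). A theorem of IK in the
-- fragment is therefore forced, hence derivable, at the empty theory. Since the
-- fragment has no ∨, ⊥ or ◇, worlds need not be prime or consistent.
module Submission where

open import Defs
open import Data.Nat using (ℕ)
open import Data.Empty using () renaming (⊥ to ⊥₀)
open import Data.Empty.Polymorphic using () renaming (⊥ to 𝟘)
open import Data.Product using (_×_; _,_; ∃-syntax)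
open import Data.Sum using (_⊎_; inj₁; inj₂)
open import Data.Unit.Polymorphic using () renaming (⊤ to 𝟙)
open import Function.Bundles using (_⇔_; mk⇔)
open import Level using (Level; Lift; lift; _⊔_) renaming (suc to lsuc)
open import Relation.Binary.PropositionalEquality using (_≡_; refl)

module ImplicationConjunctionCalculus
  {F : Set} (_⇛_ _&_ : F → F → F) (⊢_ : F → Set)
  (ax-k : ∀ p q → ⊢ (p ⇛ (q ⇛ p)))
  (ax-s : ∀ p q r → ⊢ ((p ⇛ (q ⇛ r)) ⇛ ((p ⇛ q) ⇛ (p ⇛ r))))
  (ax-&₁ : ∀ p q → ⊢ ((p & q) ⇛ p))
  (ax-&₂ : ∀ p q → ⊢ ((p & q) ⇛ q))
  (ax-&i : ∀ p q → ⊢ (p ⇛ (q ⇛ (p & q))))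
  (modus-ponens : ∀ {p q} → ⊢ (p ⇛ q) → ⊢ p → ⊢ q)
  where

  ⇛-refl : ∀ p → ⊢ (p ⇛ p)
  ⇛-refl p = modus-ponens (modus-ponens (ax-s p (p ⇛ p) p) (ax-k p (p ⇛ p))) (ax-k p p)

  ⇛-trans : ∀ {a b c} → ⊢ (a ⇛ b) → ⊢ (b ⇛ c) → ⊢ (a ⇛ c)
  ⇛-trans {a} {b} {c} ab bc =
    modus-ponens (modus-ponens (ax-s a b c) (modus-ponens (ax-k (b ⇛ c) a) bc)) ab

  curry : ∀ {a b c} → ⊢ ((a & b) ⇛ c) → ⊢ (a ⇛ (b ⇛ c))
  curry {a} {b} {c} h = ⇛-trans (ax-&i a b) b⇛-mono
    where
    b⇛-mono : ⊢ ((b ⇛ (a & b)) ⇛ (b ⇛ c))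
    b⇛-mono = modus-ponens (ax-s b (a & b) c) (modus-ponens (ax-k ((a & b) ⇛ c) b) h)

  uncurry : ∀ {a b c} → ⊢ (a ⇛ (b ⇛ c)) → ⊢ ((a & b) ⇛ c)
  uncurry {a} {b} {c} h =
    modus-ponens (modus-ponens (ax-s (a & b) b c) (⇛-trans (ax-&₁ a b) h)) (ax-&₂ a b)

  ⇛-& : ∀ {a b c} → ⊢ (a ⇛ b) → ⊢ (a ⇛ c) → ⊢ (a ⇛ (b & c))
  ⇛-& {a} {b} {c} ab ac =
    modus-ponens (modus-ponens (ax-s a c (b & c)) (⇛-trans ab (ax-&i b c))) ac

  &-intro : ∀ {a b} → ⊢ a → ⊢ b → ⊢ (a & b)
  &-intro {a} {b} x y = modus-ponens (modus-ponens (ax-&i a b) x) y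

  &-elimˡ : ∀ {a b} → ⊢ (a & b) → ⊢ a
  &-elimˡ {a} {b} = modus-ponens (ax-&₁ a b)

  &-elimʳ : ∀ {a b} → ⊢ (a & b) → ⊢ b
  &-elimʳ {a} {b} = modus-ponens (ax-&₂ a b)

module MI = ImplicationConjunctionCalculus _⇒_ _∧_ MI⊢_ ax-k ax-s ax-∧₁ ax-∧₂ ax-∧i mp
module IK = ImplicationConjunctionCalculus _⇒_ _∧_ IK⊢_ ax-k ax-s ax-∧₁ ax-∧₂ ax-∧i mp

MI-□-mono : ∀ {a b} → MI⊢ (a ⇒ b) → MI⊢ (□ a ⇒ □ b)
MI-□-mono {a} {b} a⇒b = ⇛-trans (&-elimˡ □a⇔□a∧b) (⇛-trans (&-elimˡ (ax-□∧ a b)) (ax-∧₂ (□ a) (□ b)))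
  where
  open MI
  □a⇔□a∧b : MI⊢ (□ a ⇔□ □ (a ∧ b))
  □a⇔□a∧b = re (&-intro (⇛-& (⇛-refl a) a⇒b) (ax-∧₁ a b))

MI-K : ∀ a b → MI⊢ (□ (a ⇒ b) ⇒ (□ a ⇒ □ b))
MI-K a b = curry (⇛-trans (&-elimʳ (ax-□∧ (a ⇒ b) a)) (MI-□-mono (uncurry (⇛-refl (a ⇒ b)))))
  where open MI

MI-nec : ∀ {a} → MI⊢ a → MI⊢ □ a
MI-nec {a} ⊢a = mp (MI-□-mono (mp (ax-k a ⊤) ⊢a)) (mp (MI.&-elimʳ ax-□⊤) ax-⊤)

Theory : Set₁
Theory = Fm□ → Set

data _⊢_ (Γ : Theory) : Fm□ → Set where
  hyp : ∀ {φ} → Γ φ → Γ ⊢ φ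
  thm : ∀ {φ} → MI⊢ φ → Γ ⊢ φ
  mp  : ∀ {p q} → Γ ⊢ (p ⇒ q) → Γ ⊢ p → Γ ⊢ q

module Deriv (Γ : Theory) = ImplicationConjunctionCalculus _⇒_ _∧_ (Γ ⊢_)
  (λ p q → thm (ax-k p q)) (λ p q r → thm (ax-s p q r))
  (λ p q → thm (ax-∧₁ p q)) (λ p q → thm (ax-∧₂ p q)) (λ p q → thm (ax-∧i p q)) mp

_≼_ : Theory → Theory → Set
Γ ≼ Δ = ∀ {φ} → Γ φ → Δ ⊢ φ

⊢-mono : ∀ {Γ Δ φ} → Γ ≼ Δ → Γ ⊢ φ → Δ ⊢ φ
⊢-mono Γ≼Δ (hyp h) = Γ≼Δ h
⊢-mono Γ≼Δ (thm t) = thm t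
⊢-mono Γ≼Δ (mp d e) = mp (⊢-mono Γ≼Δ d) (⊢-mono Γ≼Δ e)

≼-refl : ∀ {Γ} → Γ ≼ Γ
≼-refl = hyp

≼-trans : ∀ {Γ Δ Θ} → Γ ≼ Δ → Δ ≼ Θ → Γ ≼ Θ
≼-trans Γ≼Δ Δ≼Θ h = ⊢-mono Δ≼Θ (Γ≼Δ h)

_▸_ : Theory → Fm□ → Theory
(Γ ▸ p) ψ = Γ ψ ⊎ ψ ≡ p

▸-extends : ∀ {Γ p} → Γ ≼ (Γ ▸ p)
▸-extends h = hyp (inj₁ h)

deduction : ∀ {Γ p q} → (Γ ▸ p) ⊢ q → Γ ⊢ (p ⇒ q)
deduction {Γ} {p} (hyp (inj₁ h)) = mp (thm (ax-k _ p)) (hyp h)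
deduction {Γ} {p} (hyp (inj₂ refl)) = Deriv.⇛-refl Γ p
deduction {Γ} {p} (thm t) = mp (thm (ax-k _ p)) (thm t)
deduction {Γ} {p} (mp d e) = mp (mp (thm (ax-s p _ _)) (deduction d)) (deduction e)

unbox : Theory → Theory
unbox Γ φ = Γ ⊢ □ φ

⊢-unbox : ∀ {Γ φ} → unbox Γ ⊢ φ → Γ ⊢ □ φ
⊢-unbox (hyp h) = h
⊢-unbox (thm t) = thm (MI-nec t)
⊢-unbox (mp d e) = mp (mp (thm (MI-K _ _)) (⊢-unbox d)) (⊢-unbox e)

∅ : Theory
∅ _ = ⊥₀

∅-⊢ : ∀ {φ} → ∅ ⊢ φ → MI⊢ φ
∅-⊢ (hyp ())
∅-⊢ (thm t) = t
∅-⊢ (mp d e) = mp (∅-⊢ d) (∅-⊢ e)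

record IntuitionisticModalModel (w ℓ : Level) : Set (lsuc (w ⊔ ℓ)) where
  field
    World    : Set w
    _≤_ _R_  : World → World → Set ℓ
    ≤-refl   : ∀ {x} → x ≤ x
    ≤-trans  : ∀ {x y z} → x ≤ y → y ≤ z → x ≤ z
    ≥∘R⊆R∘≥  : ∀ {x y z} → x ≤ y → x R z → ∃[ z′ ] (y R z′ × z ≤ z′)
    R∘≤⊆≤∘R  : ∀ {x y z} → x R y → y ≤ z → ∃[ u ] (x ≤ u × u R z)
    V        : ℕ → World → Set ℓ
    V-mono   : ∀ {n x y} → x ≤ y → V n x → V n y

module Semantics {w ℓ} (M : IntuitionisticModalModel w ℓ) where
  open IntuitionisticModalModel M

  _⊩_ : World → Fm → Set (w ⊔ ℓ)
  x ⊩ var n = Lift w (V n x)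
  x ⊩ ⊤ = 𝟙
  x ⊩ ⊥ = 𝟘
  x ⊩ (p ∧ q) = (x ⊩ p) × (x ⊩ q)
  x ⊩ (p ∨ q) = (x ⊩ p) ⊎ (x ⊩ q)
  x ⊩ (p ⇒ q) = ∀ y → x ≤ y → y ⊩ p → y ⊩ q
  x ⊩ □ p = ∀ y z → x ≤ y → y R z → z ⊩ p
  x ⊩ ◇ p = ∃[ z ] (x R z × z ⊩ p)

  ⊩-mono : ∀ {x y} p → x ≤ y → x ⊩ p → y ⊩ p
  ⊩-mono (var n) x≤y (lift v) = lift (V-mono x≤y v)
  ⊩-mono ⊤ x≤y _ = _
  ⊩-mono (p ∧ q) x≤y (a , b) = ⊩-mono p x≤y a , ⊩-mono q x≤y b
  ⊩-mono (p ∨ q) x≤y (inj₁ a) = inj₁ (⊩-mono p x≤y a)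
  ⊩-mono (p ∨ q) x≤y (inj₂ b) = inj₂ (⊩-mono q x≤y b)
  ⊩-mono (p ⇒ q) x≤y f z y≤z = f z (≤-trans x≤y y≤z)
  ⊩-mono (□ p) x≤y f u v y≤u = f u v (≤-trans x≤y y≤u)
  ⊩-mono (◇ p) x≤y (z , xRz , a) =
    let (z′ , yRz′ , z≤z′) = ≥∘R⊆R∘≥ x≤y xRz in z′ , yRz′ , ⊩-mono p z≤z′ a

  soundness : ∀ {p} → IK⊢ p → ∀ x → x ⊩ p
  soundness (ax-k p q) x y _ a z y≤z _ = ⊩-mono p y≤z a
  soundness (ax-s p q r) x y _ f z y≤z g u z≤u a =
    f u (≤-trans y≤z z≤u) a u ≤-refl (g u z≤u a)
  soundness (ax-∧₁ p q) x y _ (a , _) = a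
  soundness (ax-∧₂ p q) x y _ (_ , b) = b
  soundness (ax-∧i p q) x y _ a z y≤z b = ⊩-mono p y≤z a , b
  soundness (ax-∨₁ p q) x y _ = inj₁
  soundness (ax-∨₂ p q) x y _ = inj₂
  soundness (ax-∨e p q r) x y _ f z y≤z g u z≤u (inj₁ a) = f u (≤-trans y≤z z≤u) a
  soundness (ax-∨e p q r) x y _ f z y≤z g u z≤u (inj₂ b) = g u z≤u b
  soundness (ax-⊥ p) x y _ ()
  soundness ax-⊤ x = _
  soundness (ax-K□ p q) x y _ f z y≤z g u v z≤u uRv =
    f u v (≤-trans y≤z z≤u) uRv v ≤-refl (g u v z≤u uRv)
  soundness (ax-K◇ p q) x y _ f z y≤z (v , zRv , a) = v , zRv , f z v y≤z zRv v ≤-refl a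
  soundness ax-N◇ x y _ (_ , _ , ())
  soundness (ax-◇∨ p q) x y _ (v , yRv , inj₁ a) = inj₁ (v , yRv , a)
  soundness (ax-◇∨ p q) x y _ (v , yRv , inj₂ b) = inj₂ (v , yRv , b)
  soundness (ax-FS p q) x y _ f u v y≤u uRv w v≤w a =
    let (u′ , u≤u′ , u′Rw) = R∘≤⊆≤∘R uRv v≤w
    in f u′ (≤-trans y≤u u≤u′) (w , u′Rw , a) u′ w ≤-refl u′Rw
  soundness (mp d e) x = soundness d x x ≤-refl (soundness e x)
  soundness (nec d) x y z _ _ = soundness d z

canonical : IntuitionisticModalModel (lsuc Level.zero) Level.zero
canonical = record
  { World   = Theory
  ; _≤_     = _≼_
  ; _R_     = λ Γ Δ → unbox Γ ≼ Δ
  ; ≤-refl  = ≼-refl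
  ; ≤-trans = ≼-trans
  ; ≥∘R⊆R∘≥ = λ {Γ} {Γ′} {Δ} _ _ →
      (λ φ → unbox Γ′ φ ⊎ Δ φ) , (λ h → hyp (inj₁ h)) , (λ h → hyp (inj₂ h))
  ; R∘≤⊆≤∘R = λ ΓRΔ Δ≼Θ → _ , ≼-refl , ≼-trans ΓRΔ Δ≼Θ
  ; V       = λ n Γ → Γ ⊢ var n
  ; V-mono  = ⊢-mono
  }

open Semantics canonical

forced⇒derivable : ∀ φ Γ → Γ ⊩ embed φ → Γ ⊢ φ
derivable⇒forced : ∀ φ Γ → Γ ⊢ φ → Γ ⊩ embed φ
forced⇒derivable (var n) Γ (lift d) = d
forced⇒derivable ⊤ Γ _ = thm ax-⊤
forced⇒derivable (p ∧ q) Γ (a , b) =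
  Deriv.&-intro Γ (forced⇒derivable p Γ a) (forced⇒derivable q Γ b)
forced⇒derivable (p ⇒ q) Γ f = deduction (forced⇒derivable q (Γ ▸ p)
  (f (Γ ▸ p) ▸-extends (derivable⇒forced p (Γ ▸ p) (hyp (inj₂ refl)))))
forced⇒derivable (□ p) Γ f = ⊢-unbox (forced⇒derivable p (unbox Γ) (f Γ (unbox Γ) ≼-refl ≼-refl))
derivable⇒forced (var n) Γ d = lift d
derivable⇒forced ⊤ Γ _ = _
derivable⇒forced (p ∧ q) Γ d =
  derivable⇒forced p Γ (Deriv.&-elimˡ Γ d) , derivable⇒forced q Γ (Deriv.&-elimʳ Γ d)
derivable⇒forced (p ⇒ q) Γ d Δ Γ≼Δ a =
  derivable⇒forced q Δ (mp (⊢-mono Γ≼Δ d) (forced⇒derivable p Δ a))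
derivable⇒forced (□ p) Γ d Δ Θ Γ≼Δ ΔRΘ = derivable⇒forced p Θ (ΔRΘ (⊢-mono Γ≼Δ d))

IK-□-mono : ∀ {a b} → IK⊢ (a ⇒ b) → IK⊢ (□ a ⇒ □ b)
IK-□-mono a⇒b = mp (ax-K□ _ _) (nec a⇒b)

MI⊆IK : ∀ {φ} → MI⊢ φ → IK⊢ embed φ
MI⊆IK (ax-k p q) = ax-k _ _
MI⊆IK (ax-s p q r) = ax-s _ _ _
MI⊆IK (ax-∧₁ p q) = ax-∧₁ _ _
MI⊆IK (ax-∧₂ p q) = ax-∧₂ _ _
MI⊆IK (ax-∧i p q) = ax-∧i _ _
MI⊆IK ax-⊤ = ax-⊤
MI⊆IK (ax-□∧ p q) =
  &-intro (⇛-& (IK-□-mono (ax-∧₁ P Q)) (IK-□-mono (ax-∧₂ P Q)))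
          (uncurry (⇛-trans (IK-□-mono (ax-∧i P Q)) (ax-K□ Q (P ∧ Q))))
  where
  open IK
  P = embed p
  Q = embed q
MI⊆IK ax-□⊤ = IK.&-intro (mp (ax-k ⊤ (□ ⊤)) ax-⊤) (mp (ax-k (□ ⊤) ⊤) (nec ax-⊤))
MI⊆IK (mp d e) = mp (MI⊆IK d) (MI⊆IK e)
MI⊆IK (re d) = IK.&-intro (IK-□-mono (IK.&-elimˡ e)) (IK-□-mono (IK.&-elimʳ e))
  where e = MI⊆IK d

theorem6p4 : (φ : Fm□) → (IK⊢ embed φ) ⇔ (MI⊢ φ)
theorem6p4 φ = mk⇔ IK⇒MI MI⊆IK
  where
  IK⇒MI : IK⊢ embed φ → MI⊢ φ
  IK⇒MI d = ∅-⊢ (forced⇒derivable φ ∅ (soundness d ∅))
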